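{- For all finite dynamical systems $A,B$, $\mathrm{prof}(A\times B)=\mathrm{prof}A\times\mathrm{prof}B$.
   Context: A finite dynamical system is a pair $(A,f)$ with $A$ a finite set and $f\colon A\to A$. The height of $x\in A$ is the least $h\ge 0$ such that $f^h(x)$ is periodic. $|A|_i$ is the number of states of height $i$ and $\mathrm{prof}(A,f)=(|A|_i)_{i\in\mathbb{N}}$. The product of systems is $(A\times B,f\times g)$ with $(f\times g)(a,b)=(f(a),g(b))$. The product of profiles $\mathbf{p}=(p_i)$, $\mathbf{q}=(q_i)$ is $(\mathbf{p}\times\mathbf{q})_i = p_i\sum_{j=0}^i q_j + q_i\sum_{j=0}^i p_j - p_i q_i$. -}

module Defs where

open import Data.Nat using (ℕ; zero; suc; _+_; _*_; _∸_; _≤_; _<_)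
open import Data.Fin using (Fin)
open import Data.Product using (Σ; ∃; _×_; _,_)
open import Relation.Binary.PropositionalEquality using (_≡_)
open import Relation.Nullary using (¬_)

-- A finite dynamical system: state set Fin n (any finite set is in bijection
-- with some Fin n) together with a map f : A → A.  We keep the carrier a
-- general type A so that products A × B are literally the product set.

iter : {A : Set} → (A → A) → ℕ → A → A
iter f zero    x = x
iter f (suc h) x = f (iter f h x)

Periodic : {A : Set} → (A → A) → A → Set
Periodic f y = Σ ℕ λ k → (1 ≤ k) × (iter f k y ≡ y)

HasHeight : {A : Set} → (A → A) → A → ℕ → Set
HasHeight f x h = Periodic f (iter f h x) × (∀ j → j < h → ¬ Periodic f (iter f j x))

HasCount : (A : Set) → (A → Set) → ℕ → Set
HasCount A P c =
  Σ (Fin c → A) λ e →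
    (∀ k l → e k ≡ e l → k ≡ l) ×
    (∀ k → P (e k)) ×
    (∀ x → P x → ∃ λ k → e k ≡ x)

IsProfile : (A : Set) → (A → A) → (ℕ → ℕ) → Set
IsProfile A f p = ∀ i → HasCount A (λ x → HasHeight f x i) (p i)

FDS : ℕ → Set
FDS n = Fin n → Fin n

_×ᶠ_ : {A B : Set} → (A → A) → (B → B) → (A × B → A × B)
(f ×ᶠ g) (a , b) = f a , g b

sumUpTo : (ℕ → ℕ) → ℕ → ℕ
sumUpTo p zero    = p zero
sumUpTo p (suc i) = sumUpTo p i + p (suc i)

_×ₚ_ : (ℕ → ℕ) → (ℕ → ℕ) → (ℕ → ℕ)
(p ×ₚ q) i = (p i * sumUpTo q i + q i * sumUpTo p i) ∸ p i * q i

-- The height of (a , b) under f ×ᶠ g is the larger of the heights of a and b: the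
-- product iterate is periodic exactly when both coordinates are.  Hence the states
-- of height i split disjointly into those where a has height i and b height ≤ i,
-- and those where a has height < i and b height i, which are counted by
-- p i · Σ_{j≤i} q j and (Σ_{j<i} p j) · q i; their sum is (p ×ₚ q) i.  To find the
-- height of a coordinate constructively we use that a profile makes HasHeight
-- decidable, by searching its finite enumeration.
module Submission where

open import Defs
open import Data.Nat using (ℕ; zero; suc; _+_; _*_; _∸_; _⊔_; _≤_; _<_; s≤s; _≟_)
open import Data.Nat.Properties
open import Data.Nat.Solver using (module +-*-Solver)
open import Data.Fin using (Fin)
import Data.Fin as Fin
open import Data.Fin.Properties using (+↔⊎; *↔×; any?)
open import Data.Product using (∃; ∃₂; _×_; _,_; proj₁; proj₂)
import Data.Product as Product
open import Data.Sum using (_⊎_; inj₁; inj₂; [_,_]′)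
open import Function using (_∘_; _↔_; Inverse)
open import Relation.Nullary using (¬_; Dec; yes; no; contradiction)
open import Relation.Binary.Definitions using (DecidableEquality)
open import Relation.Binary.PropositionalEquality

HasCount-cong : ∀ {A : Set} {P Q : A → Set} {c} → HasCount A P c →
                (∀ x → P x → Q x) → (∀ x → Q x → P x) → HasCount A Q c
HasCount-cong (e , inj , ok , onto) P⇒Q Q⇒P =
  e , inj , (λ k → P⇒Q _ (ok k)) , (λ x → onto x ∘ Q⇒P x)

HasCount-∅ : ∀ {A : Set} {P : A → Set} → (∀ x → ¬ P x) → HasCount A P 0
HasCount-∅ ¬P = (λ ()) , (λ ()) , (λ ()) , (λ x Px → contradiction Px (¬P x))

HasCount-↔ : ∀ {A I : Set} {P : A → Set} {c} → Fin c ↔ I → (e : I → A) →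
             (∀ i j → e i ≡ e j → i ≡ j) → (∀ i → P (e i)) → (∀ x → P x → ∃ λ i → e i ≡ x) →
             HasCount A P c
HasCount-↔ {P = P} φ e inj ok onto = e ∘ to , inj′ , ok ∘ to , onto′
  where
  open Inverse φ
  inj′ : ∀ k l → e (to k) ≡ e (to l) → k ≡ l
  inj′ k l eq = begin
    k             ≡⟨ strictlyInverseʳ k ⟨
    from (to k)   ≡⟨ cong from (inj (to k) (to l) eq) ⟩
    from (to l)   ≡⟨ strictlyInverseʳ l ⟩
    l             ∎
    where open ≡-Reasoning
  onto′ : ∀ x → P x → ∃ λ k → e (to k) ≡ x
  onto′ x Px with onto x Px
  ... | i , refl = from i , cong e (strictlyInverseˡ i)

HasCount-⊎ : ∀ {A : Set} {P Q : A → Set} {c d} → HasCount A P c → HasCount A Q d →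
             (∀ x → P x → ¬ Q x) → HasCount A (λ x → P x ⊎ Q x) (c + d)
HasCount-⊎ {P = P} {Q = Q} (e₁ , inj₁′ , ok₁ , onto₁) (e₂ , inj₂′ , ok₂ , onto₂) disjoint =
  HasCount-↔ +↔⊎ [ e₁ , e₂ ]′ inj ok onto
  where
  inj : ∀ i j → [ e₁ , e₂ ]′ i ≡ [ e₁ , e₂ ]′ j → i ≡ j
  inj (inj₁ k) (inj₁ l) eq = cong inj₁ (inj₁′ k l eq)
  inj (inj₁ k) (inj₂ l) eq = contradiction (subst Q (sym eq) (ok₂ l)) (disjoint _ (ok₁ k))
  inj (inj₂ k) (inj₁ l) eq = contradiction (subst Q eq (ok₂ k)) (disjoint _ (ok₁ l))
  inj (inj₂ k) (inj₂ l) eq = cong inj₂ (inj₂′ k l eq)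
  ok : ∀ i → P ([ e₁ , e₂ ]′ i) ⊎ Q ([ e₁ , e₂ ]′ i)
  ok (inj₁ k) = inj₁ (ok₁ k)
  ok (inj₂ k) = inj₂ (ok₂ k)
  onto : ∀ x → P x ⊎ Q x → ∃ λ i → [ e₁ , e₂ ]′ i ≡ x
  onto x (inj₁ Px) with onto₁ x Px
  ... | k , refl = inj₁ k , refl
  onto x (inj₂ Qx) with onto₂ x Qx
  ... | k , refl = inj₂ k , refl

HasCount-× : ∀ {A B : Set} {P : A → Set} {Q : B → Set} {c d} → HasCount A P c → HasCount B Q d →
             HasCount (A × B) (λ z → P (proj₁ z) × Q (proj₂ z)) (c * d)
HasCount-× {P = P} {Q = Q} (e₁ , inj₁′ , ok₁ , onto₁) (e₂ , inj₂′ , ok₂ , onto₂) =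
  HasCount-↔ *↔× (Product.map e₁ e₂) inj ok onto
  where
  inj : ∀ i j → Product.map e₁ e₂ i ≡ Product.map e₁ e₂ j → i ≡ j
  inj (k , k′) (l , l′) eq = cong₂ _,_ (inj₁′ k l (cong proj₁ eq)) (inj₂′ k′ l′ (cong proj₂ eq))
  ok : ∀ i → P (e₁ (proj₁ i)) × Q (e₂ (proj₂ i))
  ok (k , k′) = ok₁ k , ok₂ k′
  onto : ∀ z → P (proj₁ z) × Q (proj₂ z) → ∃ λ i → Product.map e₁ e₂ i ≡ z
  onto (a , b) (Pa , Qb) with onto₁ a Pa | onto₂ b Qb
  ... | k , refl | k′ , refl = (k , k′) , refl

HasCount⇒Dec : ∀ {A : Set} {P : A → Set} {c} → DecidableEquality A → HasCount A P c →
               ∀ x → Dec (P x)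
HasCount⇒Dec _≟ᴬ_ (e , _ , ok , onto) x with any? (λ k → e k ≟ᴬ x)
... | yes (k , refl) = yes (ok k)
... | no ∄k          = no (∄k ∘ onto x)

module _ {A : Set} (f : A → A) where

  iter-+ : ∀ m n x → iter f (m + n) x ≡ iter f m (iter f n x)
  iter-+ zero    n x = refl
  iter-+ (suc m) n x = cong f (iter-+ m n x)

  iter-comm : ∀ m n x → iter f m (iter f n x) ≡ iter f n (iter f m x)
  iter-comm m n x = begin
    iter f m (iter f n x)   ≡⟨ iter-+ m n x ⟨
    iter f (m + n) x        ≡⟨ cong (λ k → iter f k x) (+-comm m n) ⟩
    iter f (n + m) x        ≡⟨ iter-+ n m x ⟩
    iter f n (iter f m x)   ∎
    where open ≡-Reasoning

  iter-*-fixed : ∀ k x → iter f k x ≡ x → ∀ m → iter f (m * k) x ≡ x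
  iter-*-fixed k x fix zero    = refl
  iter-*-fixed k x fix (suc m) =
    trans (iter-+ k (m * k) x) (trans (cong (iter f k) (iter-*-fixed k x fix m)) fix)

  Periodic-iter : ∀ t {y} → Periodic f y → Periodic f (iter f t y)
  Periodic-iter t {y} (k , k≥1 , fix) = k , k≥1 , trans (iter-comm k t y) (cong (iter f t) fix)

  HeightBelow : A → ℕ → Set
  HeightBelow x i = ∃ λ j → j < i × HasHeight f x j

  module _ {x : A} {h : ℕ} (H : HasHeight f x h) where

    HasHeight⇒Periodic-iter : ∀ {k} → h ≤ k → Periodic f (iter f k x)
    HasHeight⇒Periodic-iter {k} h≤k =
      subst (Periodic f) (trans (sym (iter-+ (k ∸ h) h x)) (cong (λ t → iter f t x) (m∸n+n≡m h≤k)))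
        (Periodic-iter (k ∸ h) (proj₁ H))

    Periodic-iter⇒height≤ : ∀ {k} → Periodic f (iter f k x) → h ≤ k
    Periodic-iter⇒height≤ per = ≮⇒≥ λ k<h → proj₂ H _ k<h per

  HasHeight-unique : ∀ {x h h′} → HasHeight f x h → HasHeight f x h′ → h ≡ h′
  HasHeight-unique H H′ =
    ≤-antisym (Periodic-iter⇒height≤ H (proj₁ H′)) (Periodic-iter⇒height≤ H′ (proj₁ H))

  HasHeight⇒¬HeightBelow : ∀ {x h} → HasHeight f x h → ¬ HeightBelow x h
  HasHeight⇒¬HeightBelow H (j , j<h , H′) = <-irrefl (HasHeight-unique H′ H) j<h

  module _ {x : A} (height? : ∀ j → Dec (HasHeight f x j)) where

    aperiodic⊎HeightBelow : ∀ i → (∀ j → j < i → ¬ Periodic f (iter f j x)) ⊎ HeightBelow x i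
    aperiodic⊎HeightBelow zero = inj₁ λ _ ()
    aperiodic⊎HeightBelow (suc i) with aperiodic⊎HeightBelow i
    ... | inj₂ (j , j<i , H) = inj₂ (j , m<n⇒m<1+n j<i , H)
    ... | inj₁ aper with height? i
    ...   | yes H = inj₂ (i , n<1+n i , H)
    ...   | no ¬H = inj₁ λ j j<1+i →
                      [ aper j , (λ { refl per → ¬H (per , aper) }) ]′ (m<1+n⇒m<n∨m≡n j<1+i)

    Periodic-iter⇒HeightBelow : ∀ {i} → Periodic f (iter f i x) → HeightBelow x (suc i)
    Periodic-iter⇒HeightBelow {i} per with aperiodic⊎HeightBelow (suc i)
    ... | inj₁ aper = contradiction per (aper i (n<1+n i))
    ... | inj₂ below = below

profile⇒height? : ∀ {n} {f : FDS n} {p} → IsProfile (Fin n) f p → ∀ x j → Dec (HasHeight f x j)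
profile⇒height? hp x j = HasCount⇒Dec Fin._≟_ (hp j) x

sumBelow : (ℕ → ℕ) → ℕ → ℕ
sumBelow p zero    = 0
sumBelow p (suc i) = sumBelow p i + p i

sumBelow-suc : ∀ p i → sumBelow p (suc i) ≡ sumUpTo p i
sumBelow-suc p zero    = refl
sumBelow-suc p (suc i) = cong (_+ p (suc i)) (sumBelow-suc p i)

HeightBelow-count : ∀ {A : Set} {f : A → A} {p} → IsProfile A f p →
                    ∀ i → HasCount A (λ x → HeightBelow f x i) (sumBelow p i)
HeightBelow-count         hp zero    = HasCount-∅ λ _ ()
HeightBelow-count {f = f} hp (suc i) =
  HasCount-cong
    (HasCount-⊎ (HeightBelow-count hp i) (hp i) (λ _ below H → HasHeight⇒¬HeightBelow f H below))
    (λ _ → [ (λ (j , j<i , H) → j , m<n⇒m<1+n j<i , H) , (λ H → i , n<1+n i , H) ]′)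
    (λ _ (j , j<1+i , H) →
      [ (λ j<i → inj₁ (j , j<i , H)) , (λ { refl → inj₂ H }) ]′ (m<1+n⇒m<n∨m≡n j<1+i))

⊔≡⇒cases : ∀ {m n i} → m ⊔ n ≡ i → (m ≡ i × n ≤ i) ⊎ (m < i × n ≡ i)
⊔≡⇒cases {m} {n} refl with m ≟ m ⊔ n
... | yes m≡m⊔n = inj₁ (m≡m⊔n , m≤n⊔m m n)
... | no  m≢m⊔n = inj₂ (≤∧≢⇒< (m≤m⊔n m n) m≢m⊔n ,
                      [ (λ m⊔n≡m → contradiction (sym m⊔n≡m) m≢m⊔n) , sym ]′ (⊔-sel m n))

module _ {A B : Set} (f : A → A) (g : B → B) where

  iter-×ᶠ : ∀ k a b → iter (f ×ᶠ g) k (a , b) ≡ (iter f k a , iter g k b)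
  iter-×ᶠ zero    a b = refl
  iter-×ᶠ (suc k) a b = cong (f ×ᶠ g) (iter-×ᶠ k a b)

  Periodic-×ᶠ⁻ : ∀ {a b} → Periodic (f ×ᶠ g) (a , b) → Periodic f a × Periodic g b
  Periodic-×ᶠ⁻ {a} {b} (k , k≥1 , fix) =
    (k , k≥1 , cong proj₁ (trans (sym (iter-×ᶠ k a b)) fix)) ,
    (k , k≥1 , cong proj₂ (trans (sym (iter-×ᶠ k a b)) fix))

  Periodic-×ᶠ⁺ : ∀ {a b} → Periodic f a → Periodic g b → Periodic (f ×ᶠ g) (a , b)
  Periodic-×ᶠ⁺ {a} {b} (k , k≥1 , fixa) (l , l≥1 , fixb) =
    k * l , *-mono-≤ k≥1 l≥1 ,
    trans (iter-×ᶠ (k * l) a b)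
      (cong₂ _,_ (trans (cong (λ t → iter f t a) (*-comm k l)) (iter-*-fixed f k a fixa l))
                 (iter-*-fixed g l b fixb k))

  Periodic-iter-×ᶠ⁻ : ∀ k {a b} → Periodic (f ×ᶠ g) (iter (f ×ᶠ g) k (a , b)) →
                      Periodic f (iter f k a) × Periodic g (iter g k b)
  Periodic-iter-×ᶠ⁻ k {a} {b} = Periodic-×ᶠ⁻ ∘ subst (Periodic (f ×ᶠ g)) (iter-×ᶠ k a b)

  HasHeight-×ᶠ : ∀ {a b i j} → HasHeight f a i → HasHeight g b j → HasHeight (f ×ᶠ g) (a , b) (i ⊔ j)
  HasHeight-×ᶠ {a} {b} {i} {j} Ha Hb = periodic , minimal
    where
    periodic : Periodic (f ×ᶠ g) (iter (f ×ᶠ g) (i ⊔ j) (a , b))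
    periodic = subst (Periodic (f ×ᶠ g)) (sym (iter-×ᶠ (i ⊔ j) a b))
      (Periodic-×ᶠ⁺ (HasHeight⇒Periodic-iter f Ha (m≤m⊔n i j))
                    (HasHeight⇒Periodic-iter g Hb (m≤n⊔m i j)))
    minimal : ∀ k → k < i ⊔ j → ¬ Periodic (f ×ᶠ g) (iter (f ×ᶠ g) k (a , b))
    minimal k k<i⊔j per with Periodic-iter-×ᶠ⁻ k per
    ... | perᶠ , perᵍ =
      <⇒≱ k<i⊔j (⊔-lub (Periodic-iter⇒height≤ f Ha perᶠ) (Periodic-iter⇒height≤ g Hb perᵍ))

  module _ (heightᶠ? : ∀ a j → Dec (HasHeight f a j)) (heightᵍ? : ∀ b j → Dec (HasHeight g b j)) where

    HasHeight-×ᶠ⁻ : ∀ {a b h} → HasHeight (f ×ᶠ g) (a , b) h →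
                    ∃₂ λ i j → HasHeight f a i × HasHeight g b j × i ⊔ j ≡ h
    HasHeight-×ᶠ⁻ {a} {b} {h} H =
      let (perᶠ , perᵍ) = Periodic-iter-×ᶠ⁻ h (proj₁ H)
          (i , _ , Ha)  = Periodic-iter⇒HeightBelow f (heightᶠ? a) {h} perᶠ
          (j , _ , Hb)  = Periodic-iter⇒HeightBelow g (heightᵍ? b) {h} perᵍ
      in i , j , Ha , Hb , HasHeight-unique (f ×ᶠ g) (HasHeight-×ᶠ Ha Hb) H

    HasHeight-×ᶠ⇒cases : ∀ {a b h} → HasHeight (f ×ᶠ g) (a , b) h →
                         (HasHeight f a h × HeightBelow g b (suc h)) ⊎ (HeightBelow f a h × HasHeight g b h)
    HasHeight-×ᶠ⇒cases H =
      let (i , j , Ha , Hb , i⊔j≡h) = HasHeight-×ᶠ⁻ H in by-cases Ha Hb (⊔≡⇒cases i⊔j≡h)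
      where
      by-cases : ∀ {a b i j h} → HasHeight f a i → HasHeight g b j →
                 (i ≡ h × j ≤ h) ⊎ (i < h × j ≡ h) →
                 (HasHeight f a h × HeightBelow g b (suc h)) ⊎ (HeightBelow f a h × HasHeight g b h)
      by-cases {j = j} Ha Hb (inj₁ (refl , j≤i)) = inj₁ (Ha , j , s≤s j≤i , Hb)
      by-cases {i = i} Ha Hb (inj₂ (i<j , refl)) = inj₂ ((i , i<j , Ha) , Hb)

  cases⇒HasHeight-×ᶠ : ∀ {a b h} →
                       (HasHeight f a h × HeightBelow g b (suc h)) ⊎ (HeightBelow f a h × HasHeight g b h) →
                       HasHeight (f ×ᶠ g) (a , b) h
  cases⇒HasHeight-×ᶠ (inj₁ (Ha , j , j<1+h , Hb)) =
    subst (HasHeight (f ×ᶠ g) _) (m≥n⇒m⊔n≡m (m<1+n⇒m≤n j<1+h)) (HasHeight-×ᶠ Ha Hb)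
  cases⇒HasHeight-×ᶠ (inj₂ ((i , i<h , Ha) , Hb)) =
    subst (HasHeight (f ×ᶠ g) _) (m≤n⇒m⊔n≡n (<⇒≤ i<h)) (HasHeight-×ᶠ Ha Hb)

m*o+n*[p+m]∸m*n≡m*o+p*n : ∀ m n o p → (m * o + n * (p + m)) ∸ m * n ≡ m * o + p * n
m*o+n*[p+m]∸m*n≡m*o+p*n m n o p = begin
  (m * o + n * (p + m)) ∸ m * n   ≡⟨ cong (_∸ m * n) (regroup m n o p) ⟩
  (m * o + p * n + m * n) ∸ m * n ≡⟨ m+n∸n≡m (m * o + p * n) (m * n) ⟩
  m * o + p * n                   ∎
  where
  open ≡-Reasoning
  open +-*-Solver
  regroup : ∀ m n o p → m * o + n * (p + m) ≡ m * o + p * n + m * n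
  regroup = solve 4 (λ m n o p → m :* o :+ n :* (p :+ m) := m :* o :+ p :* n :+ m :* n) refl

×ₚ-sumBelow : ∀ p q i → (p ×ₚ q) i ≡ p i * sumBelow q (suc i) + sumBelow p i * q i
×ₚ-sumBelow p q i rewrite sym (sumBelow-suc p i) | sym (sumBelow-suc q i) =
  m*o+n*[p+m]∸m*n≡m*o+p*n (p i) (q i) (sumBelow q (suc i)) (sumBelow p i)

lemma4 : (n m : ℕ) (f : FDS n) (g : FDS m) (p q : ℕ → ℕ) →
    IsProfile (Fin n) f p → IsProfile (Fin m) g q →
    IsProfile (Fin n × Fin m) (f ×ᶠ g) (p ×ₚ q)
lemma4 n m f g p q hp hq i =
  subst (HasCount _ _) (sym (×ₚ-sumBelow p q i))
    (HasCount-cong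
      (HasCount-⊎ (HasCount-× (hp i) (HeightBelow-count hq (suc i)))
                  (HasCount-× (HeightBelow-count hp i) (hq i))
                  (λ _ (Ha , _) (below , _) → HasHeight⇒¬HeightBelow f Ha below))
      (λ _ → cases⇒HasHeight-×ᶠ f g)
      (λ _ → HasHeight-×ᶠ⇒cases f g (profile⇒height? hp) (profile⇒height? hq)))
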